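{- Let $X$ be a finite set and let $u\in\mathcal{U}^X$. Then $u$ is cyclic if and only if $$u(t,x,y)\,u(t,y,z)+u(t,x,z)\,u(x,y,z)=0\quad\text{for all } t,x,y,z\in X,$$ with arithmetic in $\mathrm{GF}(2)$.
   Context: A cyclic ordering of a finite set $X$ is an equivalence class $[x_1,\dots,x_n]$ of linear orderings of $X$ modulo rotation ($[x_1,\dots,x_n]=[x_2,\dots,x_n,x_1]$); $C\succeq[y_1,\dots,y_k]$ means $[y_1,\dots,y_k]$ arises from $C$ by omitting entries. For a cyclic ordering $C$ of $X$, $u^C\in\mathrm{GF}(2)^{X^3}$ has $u^C(x,y,z)=1$ iff $x,y,z$ are distinct and $C\succeq[x,y,z]$. A vector $u\in\mathrm{GF}(2)^{X^3}$ is cyclic if $u=u^C$ for some cyclic ordering $C$ of $X$. $\mathcal{U}^X$ is the affine subspace of all $u\in\mathrm{GF}(2)^{X^3}$ such that: $u(x,x,y)=0$ for all $x,y$; $u(x,y,z)+u(y,z,x)=0$ for all $x,y,z$; $u(x,y,z)+u(y,x,z)=1$ for all pairwise distinct $x,y,z$; and $u(t,x,y)+u(t,x,z)+u(t,y,z)+u(x,y,z)=0$ for all pairwise distinct $t,x,y,z$. -}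

module Defs where

open import Data.Nat using (ℕ; _≤_)
open import Data.Fin using (Fin)
open import Data.Bool using (Bool; true; false; _xor_; _∧_)
open import Data.List using (List; []; _∷_; _++_; take; drop; length)
open import Data.List.Relation.Unary.Unique.Propositional using (Unique)
open import Data.List.Membership.Propositional using (_∈_)
open import Data.List.Relation.Binary.Sublist.Propositional using (_⊆_)
open import Data.Product using (Σ; _×_; ∃; ∃-syntax)
open import Relation.Binary.PropositionalEquality using (_≡_; _≢_)
open import Function.Bundles using (_⇔_)

-- A finite set X is taken to be Fin n.

-- GF(2) is Bool: addition = _xor_, multiplication = _∧_, 0 = false, 1 = true.
-- Vectors in GF(2)^{X^3}:
Vec3 : ℕ → Set
Vec3 n = Fin n → Fin n → Fin n → Bool

Rot : {A : Set} → List A → List A → Set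
Rot xs ys = ∃[ k ] (k ≤ length xs × ys ≡ drop k xs ++ take k xs)

LinOrd : (n : ℕ) → List (Fin n) → Set
LinOrd n L = Unique L × (∀ x → x ∈ L)

-- A cyclic ordering is represented by any of its linear orderings L
-- (the class [L] modulo rotation).
-- [L] ⪰ [ys] : some rotation of ys arises from some rotation of L by omitting entries.
CycSub : {A : Set} → List A → List A → Set
CycSub L ys = ∃[ L' ] ∃[ ys' ] (Rot L L' × Rot ys ys' × ys' ⊆ L')

Distinct3 : {A : Set} → A → A → A → Set
Distinct3 x y z = x ≢ y × y ≢ z × x ≢ z

IsUC : (n : ℕ) → List (Fin n) → Vec3 n → Set
IsUC n L u = ∀ x y z →
  (u x y z ≡ true) ⇔ (Distinct3 x y z × CycSub L (x ∷ y ∷ z ∷ []))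

Cyclic : (n : ℕ) → Vec3 n → Set
Cyclic n u = ∃[ L ] (LinOrd n L × IsUC n L u)

InU : (n : ℕ) → Vec3 n → Set
InU n u =
  (∀ x y → u x x y ≡ false) ×
  (∀ x y z → (u x y z xor u y z x) ≡ false) ×
  (∀ x y z → Distinct3 x y z → (u x y z xor u y x z) ≡ true) ×
  (∀ t x y z → t ≢ x → t ≢ y → t ≢ z → Distinct3 x y z →
     (u t x y xor u t x z xor u t y z xor u x y z) ≡ false)

-- A cyclic ordering C is listed by a strict total order <, and u^C(x,y,z) = 1 iff (x,y,z)
-- is a rotation of a <-increasing triple.  For such u the identity expresses that in a
-- quadruple t,x,y,z the triangles txy and tyz are both positively oriented iff txz and xyz
-- are.  Conversely, fix a point t.  The identity makes x <ₜ y :⇔ u(t,x,y) = 1 transitive, and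
-- the axioms of 𝒰 make it a strict total order on X ∖ {t}; putting t first gives a strict
-- total order < on X with u(x,y,z) = 1 whenever x < y < z.  As the axioms of 𝒰 also give
-- u(x,z,y) = 1 + u(x,y,z) on distinct triples, u = u^< .
module Submission where

open import Defs
open import Data.Nat using (ℕ; zero; suc; z≤n; s≤s)
open import Data.Bool using (Bool; true; false; not; _xor_; _∧_)
open import Data.Bool.Properties using (xor-same; ∧-conicalˡ; ∧-conicalʳ)
open import Data.Empty using (⊥-elim)
open import Data.Fin using (Fin) renaming (zero to fz; suc to fs)
open import Data.Fin.Properties using (_≟_)
open import Data.List using (List; []; _∷_; _++_; take; drop; allFin)
open import Data.List.Properties using (take++drop≡id; ++-identityʳ)
open import Data.List.Membership.Propositional using (_∈_)
open import Data.List.Membership.Propositional.Properties using (∈-allFin)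
open import Data.List.Relation.Unary.All as All using (All)
open import Data.List.Relation.Unary.AllPairs as AllPairs using (AllPairs; []; _∷_)
open import Data.List.Relation.Unary.Any using (here; there)
open import Data.List.Relation.Unary.Unique.Propositional using (Unique)
open import Data.List.Relation.Unary.Unique.Propositional.Properties using (allFin⁺)
open import Data.List.Relation.Binary.Sublist.Propositional
  using (_⊆_; []; _∷_; _∷ʳ_; to∈; from∈; ⊆-trans)
open import Data.List.Relation.Binary.Sublist.Propositional.Properties using (∷ˡ⁻; ++⁺)
open import Data.List.Relation.Binary.Permutation.Propositional using (↭-sym; ↭⇒↭ₛ)
open import Data.List.Relation.Binary.Permutation.Propositional.Properties using (∈-resp-↭)
import Data.List.Relation.Binary.Permutation.Setoid.Properties as Permutationₛ
open import Data.List.Relation.Unary.Sorted.TotalOrder.Properties using (Sorted⇒AllPairs)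
import Data.List.Sort as Sort
open import Data.Product using (Σ; _×_; _,_; proj₁; proj₂; ∃₂; ∃-syntax)
open import Data.Sum using (_⊎_; inj₁; inj₂)
import Data.Sum as Sum
open import Level using (0ℓ)
open import Relation.Binary using (Rel; DecidableEquality; Tri; tri<; tri≈; tri>)
open import Relation.Binary.Bundles using (DecTotalOrder)
open import Relation.Binary.Structures using (IsStrictTotalOrder)
import Relation.Binary.Construct.StrictToNonStrict as StrictToNonStrict
open import Relation.Binary.PropositionalEquality
  using (_≡_; _≢_; refl; sym; trans; cong; cong₂; subst; setoid; isEquivalence)
open import Relation.Nullary using (¬_; yes; no)
open import Function.Bundles using (_⇔_; mk⇔; Equivalence)

open Equivalence using (to; from)

xor≡false⇒≡ : ∀ {a b} → a xor b ≡ false → a ≡ b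
xor≡false⇒≡ {false} refl = refl
xor≡false⇒≡ {true} {true} _ = refl

≡⇒xor≡false : ∀ {a b} → a ≡ b → a xor b ≡ false
≡⇒xor≡false {a} refl = xor-same a

xor≡true⇒≡not : ∀ {a b} → a xor b ≡ true → b ≡ not a
xor≡true⇒≡not {false} refl = refl
xor≡true⇒≡not {true} {false} _ = refl

∧≡true⁻ : ∀ {a b} → a ∧ b ≡ true → a ≡ true × b ≡ true
∧≡true⁻ {a} {b} p = ∧-conicalˡ a b p , ∧-conicalʳ a b p

∧-cong-true : ∀ {a b c d} →
  (a ≡ true → b ≡ true → c ≡ true × d ≡ true) →
  (c ≡ true → d ≡ true → a ≡ true × b ≡ true) →
  a ∧ b ≡ c ∧ d
∧-cong-true {true} {true} f g with f refl refl
... | refl , refl = refl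
∧-cong-true {false} {_} {true} {true} f g with g refl refl
... | () , _
∧-cong-true {true} {false} {true} {true} f g with g refl refl
... | _ , ()
∧-cong-true {false} {_} {false} f g = refl
∧-cong-true {false} {_} {true} {false} f g = refl
∧-cong-true {true} {false} {false} f g = refl
∧-cong-true {true} {false} {true} {false} f g = refl

module _ {A : Set} where

  Chain : Rel A 0ℓ → A → A → A → Set
  Chain _<_ a b c = a < b × b < c

  Rotations : (A → A → A → Set) → A → A → A → Set
  Rotations T a b c = T a b c ⊎ T b c a ⊎ T c a b

  Cyc : Rel A 0ℓ → A → A → A → Set
  Cyc _<_ = Rotations (Chain _<_)

  IsCyclicVectorOf : Rel A 0ℓ → (A → A → A → Bool) → Set
  IsCyclicVectorOf _<_ u = ∀ x y z → (u x y z ≡ true) ⇔ Cyc _<_ x y z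

  rotations-rotate : ∀ {T a b c} → Rotations T a b c → Rotations T b c a
  rotations-rotate (inj₁ t) = inj₂ (inj₂ t)
  rotations-rotate (inj₂ (inj₁ t)) = inj₁ t
  rotations-rotate (inj₂ (inj₂ t)) = inj₂ (inj₁ t)

  rotations-map : ∀ {T T′ : A → A → A → Set} → (∀ {a b c} → T a b c → T′ a b c) →
                  ∀ {a b c} → Rotations T a b c → Rotations T′ a b c
  rotations-map f = Sum.map f (Sum.map f f)

  rotations-join : ∀ {T a b c} → Rotations (Rotations T) a b c → Rotations T a b c
  rotations-join (inj₁ r) = r
  rotations-join {T} (inj₂ (inj₁ r)) = rotations-rotate {T} (rotations-rotate {T} r)
  rotations-join {T} (inj₂ (inj₂ r)) = rotations-rotate {T} r

  cyc-map : ∀ {_<_ _<′_ : Rel A 0ℓ} → (∀ {a b} → a < b → a <′ b) →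
            ∀ {a b c} → Cyc _<_ a b c → Cyc _<′_ a b c
  cyc-map {_<_} {_<′_} f = rotations-map {Chain _<_} {Chain _<′_} λ (p , q) → f p , f q

  isCyclicVectorOf-resp : ∀ {_<_ _<′_ : Rel A 0ℓ} {u} → (∀ {a b} → a < b ⇔ a <′ b) →
                          IsCyclicVectorOf _<_ u → IsCyclicVectorOf _<′_ u
  isCyclicVectorOf-resp {_<_} {_<′_} <⇔<′ isCyc x y z = mk⇔
    (λ p → cyc-map {_<_} (to <⇔<′) (to (isCyc x y z) p))
    (λ c → from (isCyc x y z) (cyc-map {_<′_} (from <⇔<′) c))

  connex⇒isStrictTotalOrder : ∀ {_<_ : Rel A 0ℓ} → DecidableEquality A →
    (∀ {a} → ¬ a < a) → (∀ {a b c} → a < b → b < c → a < c) →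
    (∀ {a b} → a ≢ b → a < b ⊎ b < a) → IsStrictTotalOrder _≡_ _<_
  connex⇒isStrictTotalOrder {_<_} _≟ₐ_ irrefl <-trans connex = record
    { isStrictPartialOrder = record
      { isEquivalence = isEquivalence
      ; irrefl = λ { refl → irrefl }
      ; trans = <-trans
      ; <-resp-≈ = (λ { refl p → p }) , (λ { refl p → p })
      }
    ; compare = compare
    }
    where
    asym : ∀ {a b} → a < b → ¬ b < a
    asym p q = irrefl (<-trans p q)
    compare : ∀ a b → Tri (a < b) (a ≡ b) (b < a)
    compare a b with a ≟ₐ b
    ... | yes refl = tri≈ irrefl refl irrefl
    ... | no a≢b with connex a≢b
    ...   | inj₁ a<b = tri< a<b a≢b (asym a<b)
    ...   | inj₂ b<a = tri> (asym b<a) a≢b b<a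

  Precedes : List A → A → A → Set
  Precedes L a b = a ∷ b ∷ [] ⊆ L

  Precedes₃ : List A → A → A → A → Set
  Precedes₃ L a b c = a ∷ b ∷ c ∷ [] ⊆ L

  ∉-head : ∀ {a : A} {L : List A} → All (a ≢_) L → ¬ a ∈ L
  ∉-head a∉L a∈L = All.lookup a∉L a∈L refl

  precedes-irrefl : ∀ {L a} → Unique L → ¬ Precedes L a a
  precedes-irrefl (_ ∷ L!) (_ ∷ʳ p) = precedes-irrefl L! p
  precedes-irrefl (a∉L ∷ _) (refl ∷ p) = ∉-head a∉L (to∈ p)

  precedes₃⇒chain : ∀ {L a b c} → Precedes₃ L a b c → Chain (Precedes L) a b c
  precedes₃⇒chain p = ⊆-trans (refl ∷ refl ∷ _ ∷ʳ []) p , ∷ˡ⁻ p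

  chain⇒precedes₃ : ∀ {L a b c} → Unique L → Chain (Precedes L) a b c → Precedes₃ L a b c
  chain⇒precedes₃ (_ ∷ L!) (_ ∷ʳ p , _ ∷ʳ q) = _ ∷ʳ chain⇒precedes₃ L! (p , q)
  chain⇒precedes₃ (_ ∷ _) (refl ∷ p , _ ∷ʳ q) = refl ∷ q
  chain⇒precedes₃ (b∉L ∷ _) (_ ∷ʳ p , refl ∷ q) = ⊥-elim (∉-head b∉L (to∈ (∷ˡ⁻ p)))
  chain⇒precedes₃ (a∉L ∷ _) (refl ∷ p , refl ∷ q) = ⊥-elim (∉-head a∉L (to∈ p))

  precedes-trans : ∀ {L a b c} → Unique L → Precedes L a b → Precedes L b c → Precedes L a c
  precedes-trans L! p q = ⊆-trans (refl ∷ _ ∷ʳ refl ∷ []) (chain⇒precedes₃ L! (p , q))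

  precedes-connex : ∀ {L a b} → a ∈ L → b ∈ L → a ≢ b → Precedes L a b ⊎ Precedes L b a
  precedes-connex (here refl) (here refl) a≢b = ⊥-elim (a≢b refl)
  precedes-connex (here refl) (there b∈L) _ = inj₁ (refl ∷ from∈ b∈L)
  precedes-connex (there a∈L) (here refl) _ = inj₂ (refl ∷ from∈ a∈L)
  precedes-connex (there a∈L) (there b∈L) a≢b =
    Sum.map (_ ∷ʳ_) (_ ∷ʳ_) (precedes-connex a∈L b∈L a≢b)

  precedes-isStrictTotalOrder : ∀ {L} → DecidableEquality A → Unique L → (∀ x → x ∈ L) →
                                IsStrictTotalOrder _≡_ (Precedes L)
  precedes-isStrictTotalOrder _≟ₐ_ L! ∈L = connex⇒isStrictTotalOrder _≟ₐ_
    (precedes-irrefl L!) (precedes-trans L!) (precedes-connex (∈L _) (∈L _))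

  precedes⇒allPairs : ∀ {_<_ : Rel A 0ℓ} {L a b} → AllPairs _<_ L → Precedes L a b → a < b
  precedes⇒allPairs (_ ∷ L<) (_ ∷ʳ p) = precedes⇒allPairs L< p
  precedes⇒allPairs (a<L ∷ _) (refl ∷ p) = All.lookup a<L (to∈ p)

  ⊆-++-split : ∀ P {Q xs : List A} → xs ⊆ P ++ Q →
          ∃₂ λ xs₁ xs₂ → xs ≡ xs₁ ++ xs₂ × xs₁ ⊆ P × xs₂ ⊆ Q
  ⊆-++-split [] {xs = xs} s = [] , xs , refl , [] , s
  ⊆-++-split (p ∷ P) (.p ∷ʳ s) with ⊆-++-split P s
  ... | xs₁ , xs₂ , eq , s₁ , s₂ = xs₁ , xs₂ , eq , p ∷ʳ s₁ , s₂
  ⊆-++-split (p ∷ P) (refl ∷ s) with ⊆-++-split P s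
  ... | xs₁ , xs₂ , refl , s₁ , s₂ = p ∷ xs₁ , xs₂ , refl , refl ∷ s₁ , s₂

  precedes₃-++-comm : ∀ P Q {a b c} → Precedes₃ (P ++ Q) a b c →
                      Rotations (Precedes₃ (Q ++ P)) a b c
  precedes₃-++-comm P Q s with ⊆-++-split P s
  ... | [] , _ , refl , s₁ , s₂ = inj₁ (++⁺ s₂ s₁)
  ... | _ ∷ [] , _ , refl , s₁ , s₂ = inj₂ (inj₁ (++⁺ s₂ s₁))
  ... | _ ∷ _ ∷ [] , _ , refl , s₁ , s₂ = inj₂ (inj₂ (++⁺ s₂ s₁))
  ... | _ ∷ _ ∷ _ ∷ [] , _ , refl , s₁ , s₂ = inj₁ (++⁺ s₂ s₁)
  ... | _ ∷ _ ∷ _ ∷ _ ∷ _ , _ , () , _ , _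

  rotation₃-⊆ : ∀ k {M : List A} {a b c} →
                drop k (a ∷ b ∷ c ∷ []) ++ take k (a ∷ b ∷ c ∷ []) ⊆ M →
                Rotations (Precedes₃ M) a b c
  rotation₃-⊆ 0 s = inj₁ s
  rotation₃-⊆ 1 s = inj₂ (inj₁ s)
  rotation₃-⊆ 2 s = inj₂ (inj₂ s)
  -- From k = 3 on, drop and take saturate: a full turn.
  rotation₃-⊆ 3 s = inj₁ s
  rotation₃-⊆ (suc (suc (suc (suc _)))) s = inj₁ s

  cycSub⇒rotations : ∀ {L a b c} → CycSub L (a ∷ b ∷ c ∷ []) → Rotations (Precedes₃ L) a b c
  cycSub⇒rotations {L} {a} {b} {c} (_ , _ , (k , _ , refl) , (k′ , _ , refl) , s) =
    subst (λ M → Rotations (Precedes₃ M) a b c) (take++drop≡id k L)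
      (rotations-join {Precedes₃ (take k L ++ drop k L)} (rotations-map
        {Precedes₃ (drop k L ++ take k L)} {Rotations (Precedes₃ (take k L ++ drop k L))}
        (precedes₃-++-comm (drop k L) (take k L)) (rotation₃-⊆ k′ s)))

  rot-refl : (L : List A) → Rot L L
  rot-refl L = 0 , z≤n , sym (++-identityʳ L)

  rotations⇒cycSub : ∀ {L a b c} → Rotations (Precedes₃ L) a b c → CycSub L (a ∷ b ∷ c ∷ [])
  rotations⇒cycSub {L} (inj₁ s) = L , _ , rot-refl L , (0 , z≤n , refl) , s
  rotations⇒cycSub {L} (inj₂ (inj₁ s)) = L , _ , rot-refl L , (1 , s≤s z≤n , refl) , s
  rotations⇒cycSub {L} (inj₂ (inj₂ s)) = L , _ , rot-refl L , (2 , s≤s (s≤s z≤n) , refl) , s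

  cycSub⇔cyc : ∀ {L a b c} → Unique L →
               CycSub L (a ∷ b ∷ c ∷ []) ⇔ Cyc (Precedes L) a b c
  cycSub⇔cyc {L} L! = mk⇔
    (λ s → rotations-map {Precedes₃ L} precedes₃⇒chain (cycSub⇒rotations s))
    (λ c → rotations⇒cycSub (rotations-map {Chain (Precedes L)} (chain⇒precedes₃ L!) c))

module CyclicOrder {A : Set} {_<_ : Rel A 0ℓ} (sto : IsStrictTotalOrder _≡_ _<_) where
  open IsStrictTotalOrder sto using (irrefl; asym; compare) renaming (trans to <-trans)

  <⇒≢ : ∀ {a b} → a < b → a ≢ b
  <⇒≢ a<b a≡b = irrefl a≡b a<b

  >⇒≢ : ∀ {a b} → b < a → a ≢ b
  >⇒≢ b<a refl = irrefl refl b<a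

  connex : ∀ {a b} → a ≢ b → a < b ⊎ b < a
  connex {a} {b} a≢b with compare a b
  ... | tri< a<b _ _ = inj₁ a<b
  ... | tri≈ _ a≡b _ = ⊥-elim (a≢b a≡b)
  ... | tri> _ _ b<a = inj₂ b<a

  cyc-distinct : ∀ {a b c} → Cyc _<_ a b c → Distinct3 a b c
  cyc-distinct (inj₁ (a<b , b<c)) = <⇒≢ a<b , <⇒≢ b<c , <⇒≢ (<-trans a<b b<c)
  cyc-distinct (inj₂ (inj₁ (b<c , c<a))) = >⇒≢ (<-trans b<c c<a) , <⇒≢ b<c , >⇒≢ c<a
  cyc-distinct (inj₂ (inj₂ (c<a , a<b))) = <⇒≢ a<b , >⇒≢ (<-trans c<a a<b) , >⇒≢ c<a

  cyc-total : ∀ {a b c} → Distinct3 a b c → Cyc _<_ a b c ⊎ Cyc _<_ a c b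
  cyc-total (a≢b , b≢c , a≢c) with connex a≢b | connex b≢c | connex a≢c
  ... | inj₁ a<b | inj₁ b<c | _ = inj₁ (inj₁ (a<b , b<c))
  ... | inj₁ a<b | inj₂ c<b | inj₁ a<c = inj₂ (inj₁ (a<c , c<b))
  ... | inj₁ a<b | inj₂ c<b | inj₂ c<a = inj₁ (inj₂ (inj₂ (c<a , a<b)))
  ... | inj₂ b<a | inj₁ b<c | inj₁ a<c = inj₂ (inj₂ (inj₂ (b<a , a<c)))
  ... | inj₂ b<a | inj₁ b<c | inj₂ c<a = inj₁ (inj₂ (inj₁ (b<c , c<a)))
  ... | inj₂ b<a | inj₂ c<b | _ = inj₂ (inj₂ (inj₁ (c<b , b<a)))

  cyc-trans : ∀ {a b c d} → Cyc _<_ a b c → Cyc _<_ a c d → Cyc _<_ a b d × Cyc _<_ b c d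
  cyc-trans (inj₁ (a<b , b<c)) (inj₁ (a<c , c<d)) =
    inj₁ (a<b , <-trans b<c c<d) , inj₁ (b<c , c<d)
  cyc-trans (inj₁ (a<b , b<c)) (inj₂ (inj₁ (c<d , d<a))) =
    ⊥-elim (asym (<-trans a<b b<c) (<-trans c<d d<a))
  cyc-trans (inj₁ (a<b , b<c)) (inj₂ (inj₂ (d<a , a<c))) =
    inj₂ (inj₂ (d<a , a<b)) , inj₂ (inj₂ (<-trans d<a a<b , b<c))
  cyc-trans (inj₂ (inj₁ (b<c , c<a))) (inj₁ (a<c , _)) = ⊥-elim (asym c<a a<c)
  cyc-trans (inj₂ (inj₁ (b<c , c<a))) (inj₂ (inj₁ (c<d , d<a))) =
    inj₂ (inj₁ (<-trans b<c c<d , d<a)) , inj₁ (b<c , c<d)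
  cyc-trans (inj₂ (inj₁ (_ , c<a))) (inj₂ (inj₂ (_ , a<c))) = ⊥-elim (asym c<a a<c)
  cyc-trans (inj₂ (inj₂ (c<a , _))) (inj₁ (a<c , _)) = ⊥-elim (asym c<a a<c)
  cyc-trans (inj₂ (inj₂ (c<a , a<b))) (inj₂ (inj₁ (c<d , d<a))) =
    inj₂ (inj₂ (d<a , a<b)) , inj₂ (inj₁ (c<d , <-trans d<a a<b))
  cyc-trans (inj₂ (inj₂ (c<a , _))) (inj₂ (inj₂ (_ , a<c))) = ⊥-elim (asym c<a a<c)

  isCyclicVectorOf⇒∧-identity : ∀ {u : A → A → A → Bool} → IsCyclicVectorOf _<_ u →
                                ∀ t x y z → u t x y ∧ u t y z ≡ u t x z ∧ u x y z
  isCyclicVectorOf⇒∧-identity {u} isCyc t x y z = ∧-cong-true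
    (λ p q → let r , s = cyc-trans (toCyc p) (toCyc q) in fromCyc r , fromCyc s)
    (λ p q → let r , s = cyc-trans (toCyc q) (rotate (toCyc p))
             in fromCyc (rotate (rotate r)) , fromCyc (rotate (rotate s)))
    where
    toCyc : ∀ {a b c} → u a b c ≡ true → Cyc _<_ a b c
    toCyc {a} {b} {c} = to (isCyc a b c)
    fromCyc : ∀ {a b c} → Cyc _<_ a b c → u a b c ≡ true
    fromCyc {a} {b} {c} = from (isCyc a b c)
    rotate : ∀ {a b c} → Cyc _<_ a b c → Cyc _<_ b c a
    rotate = rotations-rotate {T = Chain _<_}

module InU-Properties {n} {u : Vec3 n} (u∈U : InU n u) where
  u-xxy : ∀ x y → u x x y ≡ false
  u-xxy = proj₁ u∈U

  u-rotate : ∀ x y z → u x y z ≡ u y z x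
  u-rotate x y z = xor≡false⇒≡ (proj₁ (proj₂ u∈U) x y z)

  u-xyy : ∀ x y → u x y y ≡ false
  u-xyy x y = trans (u-rotate x y y) (u-xxy y x)

  u-xyx : ∀ x y → u x y x ≡ false
  u-xyx x y = trans (u-rotate x y x) (u-xyy y x)

  u-distinct : ∀ {x y z} → u x y z ≡ true → Distinct3 x y z
  u-distinct {x} {y} {z} p =
    (λ { refl → true≢false (trans (sym p) (u-xxy x z)) }) ,
    (λ { refl → true≢false (trans (sym p) (u-xyy x y)) }) ,
    (λ { refl → true≢false (trans (sym p) (u-xyx x y)) })
    where
    true≢false : true ≢ false
    true≢false ()

  u-reverse : ∀ {x y z} → Distinct3 x y z → u x z y ≡ not (u x y z)
  u-reverse {x} {y} {z} d =
    trans (sym (u-rotate y x z)) (xor≡true⇒≡not (proj₁ (proj₂ (proj₂ u∈U)) x y z d))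

  module _ {_<_ : Rel (Fin n) 0ℓ} (sto : IsStrictTotalOrder _≡_ _<_) where
    open CyclicOrder sto using (cyc-total)

    chain⇒isCyclicVectorOf : (∀ {x y z} → x < y → y < z → u x y z ≡ true) →
                             IsCyclicVectorOf _<_ u
    chain⇒isCyclicVectorOf chain⇒u x y z = mk⇔ toCyc fromCyc
      where
      fromCyc : ∀ {x y z} → Cyc _<_ x y z → u x y z ≡ true
      fromCyc (inj₁ (x<y , y<z)) = chain⇒u x<y y<z
      fromCyc {x} {y} {z} (inj₂ (inj₁ (y<z , z<x))) = trans (u-rotate x y z) (chain⇒u y<z z<x)
      fromCyc {x} {y} {z} (inj₂ (inj₂ (z<x , x<y))) =
        trans (u-rotate x y z) (trans (u-rotate y z x) (chain⇒u z<x x<y))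
      toCyc : u x y z ≡ true → Cyc _<_ x y z
      toCyc p with cyc-total (u-distinct p)
      ... | inj₁ c = c
      ... | inj₂ c with trans (sym (fromCyc c)) (trans (u-reverse (u-distinct p)) (cong not p))
      ...   | ()

isUC⇔isCyclicVectorOf : ∀ {n L} {u : Vec3 n} → LinOrd n L →
                        IsUC n L u ⇔ IsCyclicVectorOf (Precedes L) u
isUC⇔isCyclicVectorOf (L! , ∈L) = mk⇔
  (λ isUC x y z → mk⇔
    (λ p → to (cycSub⇔cyc L!) (proj₂ (to (isUC x y z) p)))
    (λ c → from (isUC x y z) (cyc-distinct c , from (cycSub⇔cyc L!) c)))
  (λ isCyc x y z → mk⇔
    (λ p → cyc-distinct (to (isCyc x y z) p) , from (cycSub⇔cyc L!) (to (isCyc x y z) p))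
    (λ (_ , s) → from (isCyc x y z) (to (cycSub⇔cyc L!) s)))
  where
  open CyclicOrder (precedes-isStrictTotalOrder _≟_ L! ∈L) using (cyc-distinct)

module _ {n} {_<_ : Rel (Fin n) 0ℓ} (sto : IsStrictTotalOrder _≡_ _<_) where
  private
    decTotalOrder : DecTotalOrder 0ℓ 0ℓ 0ℓ
    decTotalOrder = record { isDecTotalOrder = StrictToNonStrict.isDecTotalOrder _≡_ _<_ sto }
    open Sort decTotalOrder using (sort; sort-↭; sort-↗)
    open Permutationₛ (setoid (Fin n)) using (Unique-resp-↭)

  open IsStrictTotalOrder sto using (irrefl; asym)

  linearisation : ∃[ L ] (LinOrd n L × (∀ {a b} → a < b ⇔ Precedes L a b))
  linearisation = L , (L! , ∈L) , mk⇔ <⇒precedes (precedes⇒allPairs L<)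
    where
    L : List (Fin n)
    L = sort (allFin n)
    ∈L : ∀ x → x ∈ L
    ∈L x = ∈-resp-↭ (↭-sym (sort-↭ (allFin n))) (∈-allFin x)
    increasing : AllPairs (λ a b → a < b ⊎ a ≡ b) L
    increasing = Sorted⇒AllPairs (DecTotalOrder.totalOrder decTotalOrder) (sort-↗ (allFin n))
    L! : Unique L
    L! = Unique-resp-↭ (↭⇒↭ₛ (↭-sym (sort-↭ (allFin n)))) (allFin⁺ n)
    strict : ∀ {a b} → (a < b ⊎ a ≡ b) × a ≢ b → a < b
    strict (inj₁ a<b , _) = a<b
    strict (inj₂ a≡b , a≢b) = ⊥-elim (a≢b a≡b)
    L< : AllPairs _<_ L
    L< = AllPairs.zipWith strict (increasing , L!)
    <⇒precedes : ∀ {a b} → a < b → Precedes L a b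
    <⇒precedes {a} {b} a<b with precedes-connex (∈L a) (∈L b) (λ a≡b → irrefl a≡b a<b)
    ... | inj₁ p = p
    ... | inj₂ p = ⊥-elim (asym a<b (precedes⇒allPairs L< p))

cyclic⇔∃strictTotalOrder : ∀ {n} {u : Vec3 n} →
          Cyclic n u ⇔
          Σ (Rel (Fin n) 0ℓ) λ _<_ → IsStrictTotalOrder _≡_ _<_ × IsCyclicVectorOf _<_ u
cyclic⇔∃strictTotalOrder = mk⇔
  (λ (L , linOrd@(L! , ∈L) , isUC) →
    Precedes L , precedes-isStrictTotalOrder _≟_ L! ∈L , to (isUC⇔isCyclicVectorOf linOrd) isUC)
  (λ (_<_ , sto , isCyc) →
    let L , linOrd , <⇔precedes = linearisation sto
    in L , linOrd , from (isUC⇔isCyclicVectorOf linOrd) (isCyclicVectorOf-resp <⇔precedes isCyc))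

cyclic⇒∧-identity : ∀ {n} {u : Vec3 n} → Cyclic n u →
                    ∀ t x y z → u t x y ∧ u t y z ≡ u t x z ∧ u x y z
cyclic⇒∧-identity cyclic =
  let _ , sto , isCyc = to cyclic⇔∃strictTotalOrder cyclic in CyclicOrder.isCyclicVectorOf⇒∧-identity sto isCyc

module OrderFromIdentity {m} {u : Vec3 (suc m)} (u∈U : InU (suc m) u)
  (identity : ∀ t x y z → u t x y ∧ u t y z ≡ u t x z ∧ u x y z) where
  open InU-Properties {u = u} u∈U

  data _≺_ : Fin (suc m) → Fin (suc m) → Set where
    zero≺suc : ∀ {b} → fz ≺ fs b
    suc≺suc : ∀ {a b} → u fz (fs a) (fs b) ≡ true → fs a ≺ fs b

  identity-true : ∀ {t x y z} → u t x y ≡ true → u t y z ≡ true → u t x z ≡ true × u x y z ≡ true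
  identity-true {t} {x} {y} {z} p q = ∧≡true⁻ (trans (sym (identity t x y z)) (cong₂ _∧_ p q))

  ≺-irrefl : ∀ {a} → ¬ a ≺ a
  ≺-irrefl (suc≺suc p) = proj₁ (proj₂ (u-distinct p)) refl

  ≺-trans : ∀ {a b c} → a ≺ b → b ≺ c → a ≺ c
  ≺-trans zero≺suc (suc≺suc _) = zero≺suc
  ≺-trans (suc≺suc p) (suc≺suc q) = suc≺suc (proj₁ (identity-true p q))

  ≺-connex : ∀ {a b} → a ≢ b → a ≺ b ⊎ b ≺ a
  ≺-connex {fz} {fz} a≢b = ⊥-elim (a≢b refl)
  ≺-connex {fz} {fs _} _ = inj₁ zero≺suc
  ≺-connex {fs _} {fz} _ = inj₂ zero≺suc
  ≺-connex {fs a} {fs b} a≢b with u fz (fs a) (fs b) in eq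
  ... | true = inj₁ (suc≺suc eq)
  ... | false = inj₂ (suc≺suc (trans (u-reverse ((λ ()) , a≢b , (λ ()))) (cong not eq)))

  ≺-isStrictTotalOrder : IsStrictTotalOrder _≡_ _≺_
  ≺-isStrictTotalOrder = connex⇒isStrictTotalOrder _≟_ ≺-irrefl ≺-trans ≺-connex

  ≺-isCyclicVectorOf : IsCyclicVectorOf _≺_ u
  ≺-isCyclicVectorOf = chain⇒isCyclicVectorOf ≺-isStrictTotalOrder chain⇒u
    where
    chain⇒u : ∀ {x y z} → x ≺ y → y ≺ z → u x y z ≡ true
    chain⇒u zero≺suc (suc≺suc q) = q
    chain⇒u (suc≺suc p) (suc≺suc q) = proj₂ (identity-true p q)

∧-identity⇒cyclic : ∀ {n} {u : Vec3 n} → InU n u →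
                    (∀ t x y z → u t x y ∧ u t y z ≡ u t x z ∧ u x y z) → Cyclic n u
∧-identity⇒cyclic {zero} _ _ = [] , ([] , λ ()) , λ ()
∧-identity⇒cyclic {suc m} {u} u∈U identity =
  from cyclic⇔∃strictTotalOrder (_≺_ , ≺-isStrictTotalOrder , ≺-isCyclicVectorOf)
  where open OrderFromIdentity {u = u} u∈U identity

lemma2 : (n : ℕ) (u : Vec3 n) → InU n u →
    (Cyclic n u ⇔ (∀ t x y z → ((u t x y ∧ u t y z) xor (u t x z ∧ u x y z)) ≡ false))
lemma2 n u u∈U = mk⇔
  (λ cyclic t x y z → ≡⇒xor≡false (cyclic⇒∧-identity cyclic t x y z))
  (λ identity → ∧-identity⇒cyclic u∈U λ t x y z → xor≡false⇒≡ (identity t x y z))
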